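{- For every integer $n\ge0$, the number of walks of length $n$ with steps in $\{ -2,-1,+1,+2\}$ starting at altitude $0$, ending at altitude $1$ and never going below altitude $0$ equals the number of bracketings of the expression $0\,\hat{}\,0\,\hat{}\cdots\hat{}\,0$ with $n+2$ zeroes whose value is $0$.
   Context: A bracketing of a sequence of $N$ zeroes is a full parenthesization of the binary operation $x\,\hat{}\,y=x^y$ applied to the sequence (equivalently a binary tree with $N$ leaves labelled $0$); it is evaluated with the conventions $1^1=1^0=0^0=1$ and $0^1=0$. A walk moves one unit right and $s$ units vertically for each step $s$. -}

module Defs where

open import Data.Nat using (ℕ; zero; suc; _+_)
open import Data.Integer as ℤ using (ℤ; +_; -[1+_]; 0ℤ; 1ℤ)
open import Data.List using (List; []; _∷_)
open import Data.List.Relation.Unary.All using (All)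
open import Data.Bool using (Bool; true; false)
open import Data.Product using (Σ; _×_)
open import Relation.Binary.PropositionalEquality using (_≡_)

data Step : Set where
  m2 m1 p1 p2 : Step

stepVal : Step → ℤ
stepVal m2 = -[1+ 1 ]
stepVal m1 = -[1+ 0 ]
stepVal p1 = + 1
stepVal p2 = + 2

altitudes : ℤ → List Step → List ℤ
altitudes h [] = []
altitudes h (s ∷ ss) = (h ℤ.+ stepVal s) ∷ altitudes (h ℤ.+ stepVal s) ss

finalAltitude : ℤ → List Step → ℤ
finalAltitude h [] = h
finalAltitude h (s ∷ ss) = finalAltitude (h ℤ.+ stepVal s) ss

length' : List Step → ℕ
length' [] = 0
length' (_ ∷ ss) = suc (length' ss)

record Walk (n : ℕ) : Set where
  constructor walk
  field
    steps    : List Step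
    len      : length' steps ≡ n
    nonneg   : All (λ h → 0ℤ ℤ.≤ h) (altitudes 0ℤ steps)
    endsAt1  : finalAltitude 0ℤ steps ≡ 1ℤ

data Bracketing : ℕ → Set where
  leaf : Bracketing 1
  node : ∀ {m k} → Bracketing m → Bracketing k → Bracketing (m + k)

-- x ^ y with 1^1 = 1^0 = 0^0 = 1 and 0^1 = 0 (values in {0,1} as Bool).
pow : Bool → Bool → Bool
pow true  _     = true
pow false false = true
pow false true  = false

eval : ∀ {N} → Bracketing N → Bool
eval leaf = false
eval (node l r) = pow (eval l) (eval r)

ZeroBracketing : ℕ → Set
ZeroBracketing N = Σ (Bracketing N) (λ t → eval t ≡ false)

module Submission where

-- Let w_ij count the walks from height i to height j by length, and z, o the bracketings
-- of value 0, 1 by number of zeroes minus one.  Splitting a walk at its first step (from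
-- height 0) or at its first visit to 0 (from height 1) gives four polynomial equations in
-- the series w₀₀, w₀₁, w₁₀, w₁₁; splitting a bracketing at its root gives z = 1 + x z o
-- and o = x (o² + o z + z²), since 0 ^ 1 is the only power of value 0.  From these,
-- o = x z² (z + o), and (z², z o, z o, z² + o²) solves the walk equations.  Both systems
-- determine each coefficient from lower ones, so w₀₁ = z o, whose n-th coefficient counts
-- the bracketings of n + 2 zeroes of value 0.

open import Defs
open import Data.Nat using (ℕ; zero; suc; _+_; _*_; _≤_; _<_; z≤n; s≤s; _≟_)
open import Data.Nat.Properties
  using (+-comm; +-identityʳ; *-assoc; *-comm; *-distribʳ-+; *-distribˡ-+
        ; +-0-isCommutativeMonoid; +-commutativeSemigroup; ≤-refl; ≤-trans; m≤m+n; m≤n⇒m≤1+n; suc-injective; +-suc)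
open import Data.Fin using (Fin)
open import Data.Fin.Properties using (+↔⊎; *↔×; 0↔⊥; 1↔⊤)
open import Data.Fin.Permutation using (↔⇒≡)
open import Data.Product using (Σ; _×_; _,_; proj₁; proj₂)
open import Data.Product.Function.NonDependent.Propositional using (_×-cong_)
open import Data.Sum using (_⊎_; inj₁; inj₂)
open import Data.Sum.Function.Propositional using (_⊎-cong_)
open import Data.Empty using (⊥; ⊥-elim)
open import Data.Unit using (tt)
open import Data.Bool using (Bool; true; false)
open import Data.Nat.Induction using (<-rec)
open import Data.List using (List; []; _∷_)
open import Data.List.Relation.Unary.All using (All; []; _∷_)
import Data.List.Relation.Unary.All as All
open import Data.Integer as ℤ using (0ℤ; +≤+)
open import Data.Integer.Properties using (≤-irrelevant)
open import Relation.Nullary using (¬_; yes; no)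
open import Function.Bundles using (_↔_; mk↔ₛ′; Inverse)
open import Function.Properties.Inverse using (↔-sym; ↔-trans)
open import Axiom.UniquenessOfIdentityProofs.WithK using (uip)
open import Relation.Binary.PropositionalEquality
open import Algebra.Bundles using (CommutativeSemiring)
open import Algebra.Structures using (IsCommutativeSemiring)
open import Algebra.Structures.Biased using (isCommutativeSemiringˡ; isCommutativeMonoidˡ)
import Algebra.Construct.Pointwise as Pointwise
open import Algebra.Properties.CommutativeSemigroup +-commutativeSemigroup using (x∙yz≈y∙xz; interchange)

-- Formal power series with natural coefficients

Series : Set
Series = ℕ → ℕ

𝟘 : Series
𝟘 _ = 0

𝟙 : Series
𝟙 zero    = 1
𝟙 (suc _) = 0

infixl 6 _⊕_
infixl 7 _⊛_

_⊕_ : Series → Series → Series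
(a ⊕ b) n = a n + b n

tail : Series → Series
tail a n = a (suc n)

shift : Series → Series
shift a zero    = 0
shift a (suc n) = a n

𝕏 : Series
𝕏 = shift 𝟙

scale : ℕ → Series → Series
scale k a n = k * a n

-- (a ⊛ b) n = Σ_{i+j=n} a i * b j, splitting off the term i = 0.
_⊛_ : Series → Series → Series
(a ⊛ b) zero    = a 0 * b 0
(a ⊛ b) (suc n) = a 0 * b (suc n) + (tail a ⊛ b) n

⊛-congˡ : ∀ {a a′} b → a ≗ a′ → a ⊛ b ≗ a′ ⊛ b
⊛-congˡ b a≗a′ zero    = cong (_* b 0) (a≗a′ 0)
⊛-congˡ b a≗a′ (suc n) =
  cong₂ _+_ (cong (_* b (suc n)) (a≗a′ 0)) (⊛-congˡ b (λ i → a≗a′ (suc i)) n)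

⊛-congʳ : ∀ a {b b′} → b ≗ b′ → a ⊛ b ≗ a ⊛ b′
⊛-congʳ a b≗b′ zero    = cong (a 0 *_) (b≗b′ 0)
⊛-congʳ a b≗b′ (suc n) = cong₂ _+_ (cong (a 0 *_) (b≗b′ (suc n))) (⊛-congʳ (tail a) b≗b′ n)

⊛-cong : ∀ {a a′ b b′} → a ≗ a′ → b ≗ b′ → a ⊛ b ≗ a′ ⊛ b′
⊛-cong {a′ = a′} {b = b} a≗a′ b≗b′ n = trans (⊛-congˡ b a≗a′ n) (⊛-congʳ a′ b≗b′ n)

⊛-zeroˡ : ∀ b → 𝟘 ⊛ b ≗ 𝟘
⊛-zeroˡ b zero    = refl
⊛-zeroˡ b (suc n) = ⊛-zeroˡ b n

⊛-identityˡ : ∀ b → 𝟙 ⊛ b ≗ b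
⊛-identityˡ b zero    = +-identityʳ (b 0)
⊛-identityˡ b (suc n) = trans (cong (b (suc n) + 0 +_) (⊛-zeroˡ b n)) (trans (+-identityʳ _) (+-identityʳ _))

⊛-distribʳ : ∀ c a b → (a ⊕ b) ⊛ c ≗ a ⊛ c ⊕ b ⊛ c
⊛-distribʳ c a b zero    = *-distribʳ-+ (c 0) (a 0) (b 0)
⊛-distribʳ c a b (suc n) = begin
  (a 0 + b 0) * c (suc n) + ((tail a ⊕ tail b) ⊛ c) n
    ≡⟨ cong₂ _+_ (*-distribʳ-+ (c (suc n)) (a 0) (b 0)) (⊛-distribʳ c (tail a) (tail b) n) ⟩
  (a 0 * c (suc n) + b 0 * c (suc n)) + ((tail a ⊛ c) n + (tail b ⊛ c) n)
    ≡⟨ interchange (a 0 * c (suc n)) (b 0 * c (suc n)) ((tail a ⊛ c) n) ((tail b ⊛ c) n) ⟩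
  (a 0 * c (suc n) + (tail a ⊛ c) n) + (b 0 * c (suc n) + (tail b ⊛ c) n) ∎
  where open ≡-Reasoning

⊛-unfoldˡ : ∀ a b → a ⊛ b ≗ scale (a 0) b ⊕ shift (tail a ⊛ b)
⊛-unfoldˡ a b zero    = sym (+-identityʳ _)
⊛-unfoldˡ a b (suc n) = refl

scale-⊛ : ∀ k a b → scale k a ⊛ b ≗ scale k (a ⊛ b)
scale-⊛ k a b zero    = *-assoc k (a 0) (b 0)
scale-⊛ k a b (suc n) =
  trans (cong₂ _+_ (*-assoc k (a 0) (b (suc n))) (scale-⊛ k (tail a) b n)) (sym (*-distribˡ-+ k _ _))

shift-⊛ : ∀ a b → shift a ⊛ b ≗ shift (a ⊛ b)
shift-⊛ a b zero    = refl
shift-⊛ a b (suc n) = refl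

⊛-assoc : ∀ a b c → (a ⊛ b) ⊛ c ≗ a ⊛ (b ⊛ c)
⊛-assoc a b c zero    = *-assoc (a 0) (b 0) (c 0)
⊛-assoc a b c (suc n) = begin
  ((a ⊛ b) ⊛ c) (suc n)
    ≡⟨ ⊛-congˡ c (⊛-unfoldˡ a b) (suc n) ⟩
  ((scale (a 0) b ⊕ shift (tail a ⊛ b)) ⊛ c) (suc n)
    ≡⟨ ⊛-distribʳ c (scale (a 0) b) (shift (tail a ⊛ b)) (suc n) ⟩
  (scale (a 0) b ⊛ c) (suc n) + (shift (tail a ⊛ b) ⊛ c) (suc n)
    ≡⟨ cong₂ _+_ (scale-⊛ (a 0) b c (suc n)) (shift-⊛ (tail a ⊛ b) c (suc n)) ⟩
  a 0 * (b ⊛ c) (suc n) + ((tail a ⊛ b) ⊛ c) n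
    ≡⟨ cong (a 0 * (b ⊛ c) (suc n) +_) (⊛-assoc (tail a) b c n) ⟩
  a 0 * (b ⊛ c) (suc n) + (tail a ⊛ (b ⊛ c)) n ∎
  where open ≡-Reasoning

⊛-comm : ∀ a b → a ⊛ b ≗ b ⊛ a
⊛-comm a b zero             = *-comm (a 0) (b 0)
⊛-comm a b (suc zero)       =
  trans (cong₂ _+_ (*-comm (a 0) (b 1)) (*-comm (a 1) (b 0))) (+-comm (b 1 * a 0) (b 0 * a 1))
⊛-comm a b (suc (suc n)) = begin
  a 0 * b (2 + n) + (tail a ⊛ b) (suc n)
    ≡⟨ cong (a 0 * b (2 + n) +_) (⊛-comm (tail a) b (suc n)) ⟩
  a 0 * b (2 + n) + (b 0 * a (2 + n) + (tail b ⊛ tail a) n)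
    ≡⟨ cong (λ t → a 0 * b (2 + n) + (b 0 * a (2 + n) + t)) (⊛-comm (tail b) (tail a) n) ⟩
  a 0 * b (2 + n) + (b 0 * a (2 + n) + (tail a ⊛ tail b) n)
    ≡⟨ x∙yz≈y∙xz (a 0 * b (2 + n)) (b 0 * a (2 + n)) ((tail a ⊛ tail b) n) ⟩
  b 0 * a (2 + n) + (a 0 * b (2 + n) + (tail a ⊛ tail b) n)
    ≡⟨ cong (b 0 * a (2 + n) +_) (⊛-comm a (tail b) (suc n)) ⟩
  b 0 * a (2 + n) + (tail b ⊛ a) (suc n) ∎
  where open ≡-Reasoning

series-isCommutativeSemiring : IsCommutativeSemiring _≗_ _⊕_ _⊛_ 𝟘 𝟙
series-isCommutativeSemiring = isCommutativeSemiringˡ record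
  { +-isCommutativeMonoid = Pointwise.isCommutativeMonoid ℕ +-0-isCommutativeMonoid
  ; *-isCommutativeMonoid = isCommutativeMonoidˡ record
    { isSemigroup = record
      { isMagma = record { isEquivalence = Pointwise.isEquivalence ℕ isEquivalence ; ∙-cong = ⊛-cong }
      ; assoc   = ⊛-assoc
      }
    ; identityˡ = ⊛-identityˡ
    ; comm      = ⊛-comm
    }
  ; distribʳ = ⊛-distribʳ
  ; zeroˡ    = ⊛-zeroˡ
  }

series-commutativeSemiring : CommutativeSemiring _ _
series-commutativeSemiring = record { isCommutativeSemiring = series-isCommutativeSemiring }

open CommutativeSemiring series-commutativeSemiring
  using (+-cong)
  renaming (setoid to series-setoid; refl to ≗-refl; trans to ≗-trans)

𝕏⊛≗shift : ∀ a → 𝕏 ⊛ a ≗ shift a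
𝕏⊛≗shift a zero    = refl
𝕏⊛≗shift a (suc n) = ⊛-identityˡ a n

≗𝕏⊛ : ∀ {a b} → a 0 ≡ 0 → tail a ≗ b → a ≗ 𝕏 ⊛ b
≗𝕏⊛ a₀≡0 tail≗b zero    = a₀≡0
≗𝕏⊛ {b = b} a₀≡0 tail≗b (suc n) = trans (tail≗b n) (sym (⊛-identityˡ b n))

≗𝟙⊕𝕏⊛ : ∀ {a b} → a 0 ≡ 1 → tail a ≗ b → a ≗ 𝟙 ⊕ 𝕏 ⊛ b
≗𝟙⊕𝕏⊛ a₀≡1 tail≗b zero    = a₀≡1
≗𝟙⊕𝕏⊛ {b = b} a₀≡1 tail≗b (suc n) = trans (tail≗b n) (sym (⊛-identityˡ b n))

-- Uniqueness of solutions, coefficient by coefficient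

infix 4 _≗[<_]_

_≗[<_]_ : Series → ℕ → Series → Set
a ≗[< n ] b = ∀ i → i < n → a i ≡ b i

agree-refl : ∀ {n a} → a ≗[< n ] a
agree-refl i _ = refl

agree-weaken : ∀ {n a b} → a ≗[< suc n ] b → a ≗[< n ] b
agree-weaken a≗b i i<n = a≗b i (m≤n⇒m≤1+n i<n)

agree-resp : ∀ {n a a′ b b′} → a ≗ a′ → b ≗ b′ → a′ ≗[< n ] b′ → a ≗[< n ] b
agree-resp a≗a′ b≗b′ a′≗b′ i i<n = trans (a≗a′ i) (trans (a′≗b′ i i<n) (sym (b≗b′ i)))

agree-all : ∀ {a b} → (∀ n → a ≗[< n ] b) → a ≗ b
agree-all a≗b n = a≗b (suc n) n ≤-refl

⊕-agree : ∀ {n a a′ b b′} → a ≗[< n ] a′ → b ≗[< n ] b′ → a ⊕ b ≗[< n ] a′ ⊕ b′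
⊕-agree a≗a′ b≗b′ i i<n = cong₂ _+_ (a≗a′ i i<n) (b≗b′ i i<n)

⊛-agree : ∀ {n a a′ b b′} → a ≗[< n ] a′ → b ≗[< n ] b′ → a ⊛ b ≗[< n ] a′ ⊛ b′
⊛-agree a≗a′ b≗b′ zero 0<n = cong₂ _*_ (a≗a′ 0 0<n) (b≗b′ 0 0<n)
⊛-agree {suc n} a≗a′ b≗b′ (suc i) (s≤s i<n) =
  cong₂ _+_ (cong₂ _*_ (a≗a′ 0 (s≤s z≤n)) (b≗b′ (suc i) (s≤s i<n)))
            (⊛-agree (λ j j<n → a≗a′ (suc j) (s≤s j<n)) (agree-weaken b≗b′) i i<n)

shift-agree : ∀ {n a b} → a ≗[< n ] b → shift a ≗[< suc n ] shift b
shift-agree a≗b zero    _         = refl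
shift-agree a≗b (suc i) (s≤s i<n) = a≗b i i<n

𝕏⊛-agree : ∀ {n a b} → a ≗[< n ] b → 𝕏 ⊛ a ≗[< suc n ] 𝕏 ⊛ b
𝕏⊛-agree {a = a} {b} a≗b = agree-resp (𝕏⊛≗shift a) (𝕏⊛≗shift b) (shift-agree a≗b)

linear-unique : ∀ {y y′ c d} → y ≗ 𝕏 ⊛ (y ⊛ c ⊕ d) → y′ ≗ 𝕏 ⊛ (y′ ⊛ c ⊕ d) → y ≗ y′
linear-unique {y} {y′} y-eq y′-eq = agree-all agreeBelow
  where
  agreeBelow : ∀ n → y ≗[< n ] y′
  agreeBelow zero    = λ _ ()
  agreeBelow (suc n) =
    agree-resp y-eq y′-eq (𝕏⊛-agree (⊕-agree (⊛-agree (agreeBelow n) agree-refl) agree-refl))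

record WalkEquations (w₀₀ w₀₁ w₁₀ w₁₁ : Series) : Set where
  field
    eq₀₀ : w₀₀ ≗ 𝟙 ⊕ 𝕏 ⊛ (w₁₀ ⊕ 𝕏 ⊛ ((w₁₀ ⊕ w₁₁) ⊛ w₀₀))
    eq₀₁ : w₀₁ ≗ 𝕏 ⊛ (w₁₁ ⊕ (w₁₀ ⊕ 𝕏 ⊛ ((w₁₀ ⊕ w₁₁) ⊛ w₀₁)))
    eq₁₀ : w₁₀ ≗ 𝕏 ⊛ ((w₀₀ ⊕ w₀₁) ⊛ w₀₀)
    eq₁₁ : w₁₁ ≗ w₀₀ ⊕ 𝕏 ⊛ ((w₀₀ ⊕ w₀₁) ⊛ w₀₁)

WalkEquations-unique : ∀ {w₀₀ w₀₁ w₁₀ w₁₁ w′₀₀ w′₀₁ w′₁₀ w′₁₁} →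
  WalkEquations w₀₀ w₀₁ w₁₀ w₁₁ → WalkEquations w′₀₀ w′₀₁ w′₁₀ w′₁₁ →
  w₀₀ ≗ w′₀₀ × w₀₁ ≗ w′₀₁ × w₁₀ ≗ w′₁₀ × w₁₁ ≗ w′₁₁
WalkEquations-unique {w₀₀} {w₀₁} {w₁₀} {w₁₁} {w′₀₀} {w′₀₁} {w′₁₀} {w′₁₁} W W′ =
  agree-all (λ n → proj₁ (agreeBelow n)) ,
  agree-all (λ n → proj₁ (proj₂ (agreeBelow n))) ,
  agree-all (λ n → proj₁ (proj₂ (proj₂ (agreeBelow n)))) ,
  agree-all (λ n → proj₂ (proj₂ (proj₂ (agreeBelow n))))
  where
  open WalkEquations W
  module W′ = WalkEquations W′

  agreeBelow : ∀ n → w₀₀ ≗[< n ] w′₀₀ × w₀₁ ≗[< n ] w′₀₁ × w₁₀ ≗[< n ] w′₁₀ × w₁₁ ≗[< n ] w′₁₁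
  agreeBelow zero = (λ _ ()) , (λ _ ()) , (λ _ ()) , (λ _ ())
  agreeBelow (suc n) with agreeBelow n
  ... | h₀₀ , h₀₁ , h₁₀ , h₁₁ = h₀₀′ , h₀₁′ , h₁₀′ , h₁₁′
    where
    h₀₀′ : w₀₀ ≗[< suc n ] w′₀₀
    h₀₀′ = agree-resp eq₀₀ W′.eq₀₀ (⊕-agree agree-refl (𝕏⊛-agree
             (⊕-agree h₁₀ (agree-weaken (𝕏⊛-agree (⊛-agree (⊕-agree h₁₀ h₁₁) h₀₀))))))
    h₀₁′ : w₀₁ ≗[< suc n ] w′₀₁
    h₀₁′ = agree-resp eq₀₁ W′.eq₀₁ (𝕏⊛-agree
             (⊕-agree h₁₁ (⊕-agree h₁₀ (agree-weaken (𝕏⊛-agree (⊛-agree (⊕-agree h₁₀ h₁₁) h₀₁))))))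
    h₁₀′ : w₁₀ ≗[< suc n ] w′₁₀
    h₁₀′ = agree-resp eq₁₀ W′.eq₁₀ (𝕏⊛-agree (⊛-agree (⊕-agree h₀₀ h₀₁) h₀₀))
    h₁₁′ : w₁₁ ≗[< suc n ] w′₁₁
    h₁₁′ = agree-resp eq₁₁ W′.eq₁₁ (⊕-agree h₀₀′ (𝕏⊛-agree (⊛-agree (⊕-agree h₀₀ h₀₁) h₀₁)))

module _ {z o : Series}
         (z-eq : z ≗ 𝟙 ⊕ 𝕏 ⊛ (z ⊛ o))
         (o-eq : o ≗ 𝕏 ⊛ (o ⊛ o ⊕ o ⊛ z ⊕ z ⊛ z))
  where

  open import Algebra.Solver.Ring.NaturalCoefficients.Default series-commutativeSemiring
    using (solve; _:+_; _:*_; _:=_; con)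
  open import Relation.Binary.Reasoning.Setoid series-setoid

  z⊕o-eq : z ⊕ o ≗ 𝟙 ⊕ 𝕏 ⊛ ((z ⊕ o) ⊛ (z ⊕ o))
  z⊕o-eq = begin
    z ⊕ o                                          ≈⟨ +-cong z-eq o-eq ⟩
    (𝟙 ⊕ 𝕏 ⊛ (z ⊛ o)) ⊕ 𝕏 ⊛ (o ⊛ o ⊕ o ⊛ z ⊕ z ⊛ z)
      ≈⟨ solve 3 (λ x z o → (con 1 :+ x :* (z :* o)) :+ x :* (o :* o :+ o :* z :+ z :* z)
                          := con 1 :+ x :* ((z :+ o) :* (z :+ o))) ≗-refl 𝕏 z o ⟩
    𝟙 ⊕ 𝕏 ⊛ ((z ⊕ o) ⊛ (z ⊕ o))                    ∎

  -- Both sides solve y = 𝕏 (y (z + o) + z²).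
  o≗𝕏⊛z²⊛[z⊕o] : o ≗ 𝕏 ⊛ (z ⊛ z ⊛ (z ⊕ o))
  o≗𝕏⊛z²⊛[z⊕o] = linear-unique o-linear q-linear
    where
    o-linear : o ≗ 𝕏 ⊛ (o ⊛ (z ⊕ o) ⊕ z ⊛ z)
    o-linear = ≗-trans o-eq
      (solve 3 (λ x z o → x :* (o :* o :+ o :* z :+ z :* z) := x :* (o :* (z :+ o) :+ z :* z)) ≗-refl 𝕏 z o)

    q-linear : 𝕏 ⊛ (z ⊛ z ⊛ (z ⊕ o)) ≗ 𝕏 ⊛ (𝕏 ⊛ (z ⊛ z ⊛ (z ⊕ o)) ⊛ (z ⊕ o) ⊕ z ⊛ z)
    q-linear = begin
      𝕏 ⊛ (z ⊛ z ⊛ (z ⊕ o))                           ≈⟨ ⊛-cong ≗-refl (⊛-cong ≗-refl z⊕o-eq) ⟩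
      𝕏 ⊛ (z ⊛ z ⊛ (𝟙 ⊕ 𝕏 ⊛ ((z ⊕ o) ⊛ (z ⊕ o))))
        ≈⟨ solve 3 (λ x z o → x :* (z :* z :* (con 1 :+ x :* ((z :+ o) :* (z :+ o))))
                            := x :* (x :* (z :* z :* (z :+ o)) :* (z :+ o) :+ z :* z)) ≗-refl 𝕏 z o ⟩
      𝕏 ⊛ (𝕏 ⊛ (z ⊛ z ⊛ (z ⊕ o)) ⊛ (z ⊕ o) ⊕ z ⊛ z)    ∎

  tree-WalkEquations : WalkEquations (z ⊛ z) (z ⊛ o) (z ⊛ o) (z ⊛ z ⊕ o ⊛ o)
  tree-WalkEquations = record
    { eq₀₀ = begin
        z ⊛ z                                    ≈⟨ ⊛-cong ≗-refl z-eq ⟩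
        z ⊛ (𝟙 ⊕ 𝕏 ⊛ (z ⊛ o))
          ≈⟨ solve 3 (λ x z o → z :* (con 1 :+ x :* (z :* o)) := z :+ x :* (z :* z) :* o) ≗-refl 𝕏 z o ⟩
        z ⊕ 𝕏 ⊛ (z ⊛ z) ⊛ o                      ≈⟨ +-cong z-eq (⊛-cong ≗-refl o-eq) ⟩
        (𝟙 ⊕ 𝕏 ⊛ (z ⊛ o)) ⊕ 𝕏 ⊛ (z ⊛ z) ⊛ (𝕏 ⊛ (o ⊛ o ⊕ o ⊛ z ⊕ z ⊛ z))
          ≈⟨ solve 3 (λ x z o → (con 1 :+ x :* (z :* o)) :+ x :* (z :* z) :* (x :* (o :* o :+ o :* z :+ z :* z))
                              := con 1 :+ x :* (z :* o :+ x :* ((z :* o :+ (z :* z :+ o :* o)) :* (z :* z))))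
                   ≗-refl 𝕏 z o ⟩
        𝟙 ⊕ 𝕏 ⊛ (z ⊛ o ⊕ 𝕏 ⊛ ((z ⊛ o ⊕ (z ⊛ z ⊕ o ⊛ o)) ⊛ (z ⊛ z))) ∎
    ; eq₀₁ = begin
        z ⊛ o                                    ≈⟨ ⊛-congˡ o z-eq ⟩
        (𝟙 ⊕ 𝕏 ⊛ (z ⊛ o)) ⊛ o
          ≈⟨ solve 3 (λ x z o → (con 1 :+ x :* (z :* o)) :* o := o :+ x :* (z :* o) :* o) ≗-refl 𝕏 z o ⟩
        o ⊕ 𝕏 ⊛ (z ⊛ o) ⊛ o                      ≈⟨ +-cong o-eq (⊛-cong ≗-refl o-eq) ⟩
        𝕏 ⊛ (o ⊛ o ⊕ o ⊛ z ⊕ z ⊛ z) ⊕ 𝕏 ⊛ (z ⊛ o) ⊛ (𝕏 ⊛ (o ⊛ o ⊕ o ⊛ z ⊕ z ⊛ z))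
          ≈⟨ solve 3 (λ x z o → x :* (o :* o :+ o :* z :+ z :* z) :+ x :* (z :* o) :* (x :* (o :* o :+ o :* z :+ z :* z))
                              := x :* ((z :* z :+ o :* o) :+ (z :* o :+ x :* ((z :* o :+ (z :* z :+ o :* o)) :* (z :* o)))))
                   ≗-refl 𝕏 z o ⟩
        𝕏 ⊛ ((z ⊛ z ⊕ o ⊛ o) ⊕ (z ⊛ o ⊕ 𝕏 ⊛ ((z ⊛ o ⊕ (z ⊛ z ⊕ o ⊛ o)) ⊛ (z ⊛ o)))) ∎
    ; eq₁₀ = begin
        z ⊛ o                                    ≈⟨ ⊛-cong ≗-refl o≗𝕏⊛z²⊛[z⊕o] ⟩
        z ⊛ (𝕏 ⊛ (z ⊛ z ⊛ (z ⊕ o)))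
          ≈⟨ solve 3 (λ x z o → z :* (x :* (z :* z :* (z :+ o))) := x :* ((z :* z :+ z :* o) :* (z :* z))) ≗-refl 𝕏 z o ⟩
        𝕏 ⊛ ((z ⊛ z ⊕ z ⊛ o) ⊛ (z ⊛ z))          ∎
    ; eq₁₁ = begin
        z ⊛ z ⊕ o ⊛ o                            ≈⟨ +-cong ≗-refl (⊛-congˡ o o≗𝕏⊛z²⊛[z⊕o]) ⟩
        z ⊛ z ⊕ 𝕏 ⊛ (z ⊛ z ⊛ (z ⊕ o)) ⊛ o
          ≈⟨ solve 3 (λ x z o → z :* z :+ x :* (z :* z :* (z :+ o)) :* o
                              := z :* z :+ x :* ((z :* z :+ z :* o) :* (z :* o))) ≗-refl 𝕏 z o ⟩
        z ⊛ z ⊕ 𝕏 ⊛ ((z ⊛ z ⊕ z ⊛ o) ⊛ (z ⊛ o))  ∎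
    }

-- Finite types and convolutions

Finite : Set → Set
Finite A = Σ ℕ λ k → A ↔ Fin k

↔Fin-injective : ∀ {A : Set} {m n} → A ↔ Fin m → A ↔ Fin n → m ≡ n
↔Fin-injective A↔m A↔n = ↔⇒≡ (↔-trans (↔-sym A↔m) A↔n)

⊎-↔Fin : ∀ {A B : Set} {m n} → A ↔ Fin m → B ↔ Fin n → (A ⊎ B) ↔ Fin (m + n)
⊎-↔Fin A↔m B↔n = ↔-trans (A↔m ⊎-cong B↔n) (↔-sym +↔⊎)

×-↔Fin : ∀ {A B : Set} {m n} → A ↔ Fin m → B ↔ Fin n → (A × B) ↔ Fin (m * n)
×-↔Fin A↔m B↔n = ↔-trans (A↔m ×-cong B↔n) (↔-sym *↔×)

¬⇒↔Fin0 : ∀ {A : Set} → ¬ A → A ↔ Fin 0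
¬⇒↔Fin0 ¬A = ↔-trans (mk↔ₛ′ ¬A (λ ()) (λ ()) (λ a → ⊥-elim (¬A a))) (↔-sym 0↔⊥)

¬⇒⊎-identityˡ : ∀ {A B : Set} → ¬ A → (A ⊎ B) ↔ B
¬⇒⊎-identityˡ {A} {B} ¬A = mk↔ₛ′ to inj₂ (λ _ → refl) from∘to
  where
  to : A ⊎ B → B
  to (inj₁ a) = ⊥-elim (¬A a)
  to (inj₂ b) = b
  from∘to : ∀ w → inj₂ (to w) ≡ w
  from∘to (inj₁ a) = ⊥-elim (¬A a)
  from∘to (inj₂ b) = refl

Convolution : (ℕ → Set) → (ℕ → Set) → ℕ → Set
Convolution A B n = Σ ℕ λ i → Σ ℕ λ j → i + j ≡ n × A i × B j

module _ {A B : ℕ → Set} where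

  Convolution-zero : Convolution A B 0 ↔ (A 0 × B 0)
  Convolution-zero = mk↔ₛ′ to from (λ _ → refl) from∘to
    where
    to : Convolution A B 0 → A 0 × B 0
    to (0 , 0 , refl , x , y) = x , y
    from : A 0 × B 0 → Convolution A B 0
    from (x , y) = 0 , 0 , refl , x , y
    from∘to : ∀ c → from (to c) ≡ c
    from∘to (0 , 0 , refl , x , y) = refl

  Convolution-suc : ∀ {n} → Convolution A B (suc n) ↔ (A 0 × B (suc n) ⊎ Convolution (λ i → A (suc i)) B n)
  Convolution-suc = mk↔ₛ′ to from to∘from from∘to
    where
    to : ∀ {n} → Convolution A B (suc n) → A 0 × B (suc n) ⊎ Convolution (λ i → A (suc i)) B n
    to (zero  , j , refl , x , y) = inj₁ (x , y)
    to (suc i , j , refl , x , y) = inj₂ (i , j , refl , x , y)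
    from : ∀ {n} → A 0 × B (suc n) ⊎ Convolution (λ i → A (suc i)) B n → Convolution A B (suc n)
    from (inj₁ (x , y))              = zero , _ , refl , x , y
    from (inj₂ (i , j , refl , x , y)) = suc i , j , refl , x , y
    to∘from : ∀ {n} (c : A 0 × B (suc n) ⊎ Convolution (λ i → A (suc i)) B n) → to (from c) ≡ c
    to∘from (inj₁ _)                    = refl
    to∘from (inj₂ (i , j , refl , x , y)) = refl
    from∘to : ∀ {n} (c : Convolution A B (suc n)) → from (to c) ≡ c
    from∘to (zero  , j , refl , x , y) = refl
    from∘to (suc i , j , refl , x , y) = refl

  Convolution-shift : ¬ A 0 → ¬ B 0 → ∀ {n} →
    Convolution A B (2 + n) ↔ Convolution (λ i → A (suc i)) (λ j → B (suc j)) n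
  Convolution-shift ¬A₀ ¬B₀ = mk↔ₛ′ to from to∘from from∘to
    where
    to : ∀ {n} → Convolution A B (2 + n) → Convolution (λ i → A (suc i)) (λ j → B (suc j)) n
    to (zero  , j     , e , x , y) = ⊥-elim (¬A₀ x)
    to (suc i , zero  , e , x , y) = ⊥-elim (¬B₀ y)
    to (suc i , suc j , e , x , y) = i , j , suc-injective (trans (sym (+-suc i j)) (suc-injective e)) , x , y
    from : ∀ {n} → Convolution (λ i → A (suc i)) (λ j → B (suc j)) n → Convolution A B (2 + n)
    from (i , j , e , x , y) = suc i , suc j , cong suc (trans (+-suc i j) (cong suc e)) , x , y
    to∘from : ∀ {n} (c : Convolution (λ i → A (suc i)) (λ j → B (suc j)) n) → to (from c) ≡ c
    to∘from (i , j , e , x , y) = cong (λ e′ → i , j , e′ , x , y) (uip _ _)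
    from∘to : ∀ {n} (c : Convolution A B (2 + n)) → from (to c) ≡ c
    from∘to (zero  , j     , e , x , y) = ⊥-elim (¬A₀ x)
    from∘to (suc i , zero  , e , x , y) = ⊥-elim (¬B₀ y)
    from∘to (suc i , suc j , e , x , y) = cong (λ e′ → suc i , suc j , e′ , x , y) (uip _ _)

  Convolution-one : ¬ A 0 → ¬ B 0 → ¬ Convolution A B 1
  Convolution-one ¬A₀ ¬B₀ (zero      , _     , _  , x , _) = ¬A₀ x
  Convolution-one ¬A₀ ¬B₀ (suc zero  , zero  , _  , _ , y) = ¬B₀ y
  Convolution-one ¬A₀ ¬B₀ (suc zero  , suc j , () , _ , _)
  Convolution-one ¬A₀ ¬B₀ (suc (suc i) , j   , () , _ , _)

Convolution↔Fin : ∀ {A B : ℕ → Set} {a b : Series} →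
  (∀ i → A i ↔ Fin (a i)) → (∀ j → B j ↔ Fin (b j)) → ∀ n → Convolution A B n ↔ Fin ((a ⊛ b) n)
Convolution↔Fin A↔a B↔b zero    = ↔-trans Convolution-zero (×-↔Fin (A↔a 0) (B↔b 0))
Convolution↔Fin A↔a B↔b (suc n) = ↔-trans Convolution-suc
  (⊎-↔Fin (×-↔Fin (A↔a 0) (B↔b (suc n))) (Convolution↔Fin (λ i → A↔a (suc i)) B↔b n))

Convolution-finite : ∀ {A B : ℕ → Set} n →
  (∀ {i} → i ≤ n → Finite (A i)) → (∀ {j} → j ≤ n → Finite (B j)) → Finite (Convolution A B n)
Convolution-finite zero A-fin B-fin =
  _ , ↔-trans Convolution-zero (×-↔Fin (proj₂ (A-fin z≤n)) (proj₂ (B-fin z≤n)))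
Convolution-finite (suc n) A-fin B-fin =
  _ , ↔-trans Convolution-suc (⊎-↔Fin (×-↔Fin (proj₂ (A-fin z≤n)) (proj₂ (B-fin ≤-refl)))
        (proj₂ (Convolution-finite n (λ i≤n → A-fin (s≤s i≤n)) (λ j≤n → B-fin (m≤n⇒m≤1+n j≤n)))))

≡-finite : (a b : ℕ) → Finite (a ≡ b)
≡-finite a b with a ≟ b
... | yes refl = 1 , ↔-trans (mk↔ₛ′ (λ _ → tt) (λ _ → refl) (λ _ → refl) (uip refl)) (↔-sym 1↔⊤)
... | no a≢b   = 0 , ¬⇒↔Fin0 a≢b

-- Paths of moves between heights in ℕ

-- Up-moves end at a + 1 and a + 2 rather than suc a, so that ℤ.+ a ℤ.+ stepVal s
-- computes to the target height.
data Move : ℕ → ℕ → Set where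
  up1   : ∀ {a} → Move a (a + 1)
  up2   : ∀ {a} → Move a (a + 2)
  down1 : ∀ {a} → Move (suc a) a
  down2 : ∀ {a} → Move (2 + a) a

infixr 5 _∷_ _++_
infixl 5 _∷ʳ_

data Path : ℕ → ℕ → ℕ → Set where
  []  : ∀ {a} → Path 0 a a
  _∷_ : ∀ {n a a′ b} → Move a a′ → Path n a′ b → Path (suc n) a b

_∷ʳ_ : ∀ {n a b c} → Path n a b → Move b c → Path (suc n) a c
[]      ∷ʳ m′ = m′ ∷ []
(m ∷ p) ∷ʳ m′ = m ∷ (p ∷ʳ m′)

_++_ : ∀ {m n a b c} → Path m a b → Path n b c → Path (m + n) a c
[]      ++ q = q
(m ∷ p) ++ q = m ∷ (p ++ q)

raiseMove : ∀ {a a′} → Move a a′ → Move (suc a) (suc a′)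
raiseMove up1   = up1
raiseMove up2   = up2
raiseMove down1 = down1
raiseMove down2 = down2

raise : ∀ {n a b} → Path n a b → Path n (suc a) (suc b)
raise []      = []
raise (m ∷ p) = raiseMove m ∷ raise p

-- First-hit decomposition

Raised : ℕ → ℕ → ℕ → Set
Raised n a zero    = ⊥
Raised n a (suc b) = Path n a b

-- A path of length suc i from a + 1 to 0 visiting 0 only at its end: a raised path
-- to height 1 or 2 followed by down1 or down2.
Landing : ℕ → ℕ → Set
Landing a zero    = ⊥
Landing a (suc i) = Path i a 0 ⊎ Path i a 1

landingPath : ∀ {i a} → Landing a i → Path i (suc a) 0
landingPath {suc i} (inj₁ x) = raise x ∷ʳ down1
landingPath {suc i} (inj₂ x) = raise x ∷ʳ down2

FirstHit : ℕ → ℕ → ℕ → Set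
FirstHit n a b = Raised n a b ⊎ Convolution (Landing a) (λ j → Path j 0 b) n

prependLanding : ∀ {i a a′} → Move a a′ → Landing a′ i → Landing a (suc i)
prependLanding {suc i} m (inj₁ x) = inj₁ (m ∷ x)
prependLanding {suc i} m (inj₂ x) = inj₂ (m ∷ x)

prepend : ∀ {n a a′ b} → Move a a′ → FirstHit n a′ b → FirstHit (suc n) a b
prepend m (inj₂ (i , j , refl , ℓ , y)) = inj₂ (suc i , j , refl , prependLanding m ℓ , y)
prepend {b = suc b} m (inj₁ q)          = inj₁ (m ∷ q)

decompose : ∀ {n a b} → Path n (suc a) b → FirstHit n a b
decompose []                        = inj₁ []
decompose (up1 ∷ p)                 = prepend up1 (decompose p)
decompose (up2 ∷ p)                 = prepend up2 (decompose p)
decompose {a = zero}  (down1 ∷ p)   = inj₂ (1 , _ , refl , inj₁ [] , p)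
decompose {a = suc a} (down1 ∷ p)   = prepend down1 (decompose p)
decompose {a = 1}     (down2 ∷ p)   = inj₂ (1 , _ , refl , inj₂ [] , p)
decompose {a = suc (suc a)} (down2 ∷ p)   = prepend down2 (decompose p)

recompose : ∀ {n a b} → FirstHit n a b → Path n (suc a) b
recompose (inj₂ (i , j , refl , ℓ , y)) = landingPath ℓ ++ y
recompose {b = suc b} (inj₁ q)          = raise q

recompose-prepend : ∀ {n a a′ b} (m : Move a a′) (w : FirstHit n a′ b) →
                    recompose (prepend m w) ≡ raiseMove m ∷ recompose w
recompose-prepend m (inj₂ (suc i , j , refl , inj₁ x , y)) = refl
recompose-prepend m (inj₂ (suc i , j , refl , inj₂ x , y)) = refl
recompose-prepend {b = suc b} m (inj₁ q)                   = refl

decompose-raiseMove : ∀ {n a a′ b} (m : Move a a′) (p : Path n (suc a′) b) →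
                      decompose (raiseMove m ∷ p) ≡ prepend m (decompose p)
decompose-raiseMove up1   p = refl
decompose-raiseMove up2   p = refl
decompose-raiseMove down1 p = refl
decompose-raiseMove down2 p = refl

recompose∘decompose : ∀ {n a b} (p : Path n (suc a) b) → recompose (decompose p) ≡ p
recompose∘decompose []                      = refl
recompose∘decompose (up1 ∷ p)               =
  trans (recompose-prepend up1 (decompose p)) (cong (up1 ∷_) (recompose∘decompose p))
recompose∘decompose (up2 ∷ p)               =
  trans (recompose-prepend up2 (decompose p)) (cong (up2 ∷_) (recompose∘decompose p))
recompose∘decompose {a = zero}  (down1 ∷ p) = refl
recompose∘decompose {a = suc a} (down1 ∷ p) =
  trans (recompose-prepend down1 (decompose p)) (cong (down1 ∷_) (recompose∘decompose p))
recompose∘decompose {a = 1}     (down2 ∷ p) = refl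
recompose∘decompose {a = suc (suc a)} (down2 ∷ p) =
  trans (recompose-prepend down2 (decompose p)) (cong (down2 ∷_) (recompose∘decompose p))

decompose-raise : ∀ {n a b} (q : Path n a b) → decompose (raise q) ≡ inj₁ q
decompose-raise []      = refl
decompose-raise (m ∷ q) = trans (decompose-raiseMove m (raise q)) (cong (prepend m) (decompose-raise q))

decompose-landing : ∀ {i j a b} (ℓ : Landing a i) (y : Path j 0 b) →
                    decompose (landingPath ℓ ++ y) ≡ inj₂ (i , j , refl , ℓ , y)
decompose-landing {suc i} (inj₁ [])      y = refl
decompose-landing {suc i} (inj₂ [])      y = refl
decompose-landing {suc i} (inj₁ (m ∷ x)) y =
  trans (decompose-raiseMove m _) (cong (prepend m) (decompose-landing (inj₁ x) y))
decompose-landing {suc i} (inj₂ (m ∷ x)) y =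
  trans (decompose-raiseMove m _) (cong (prepend m) (decompose-landing (inj₂ x) y))

decompose∘recompose : ∀ {n a b} (w : FirstHit n a b) → decompose (recompose w) ≡ w
decompose∘recompose (inj₂ (i , j , refl , ℓ , y)) = decompose-landing ℓ y
decompose∘recompose {b = suc b} (inj₁ q)          = decompose-raise q

Path↔FirstHit : ∀ {n a b} → Path n (suc a) b ↔ FirstHit n a b
Path↔FirstHit = mk↔ₛ′ decompose recompose decompose∘recompose recompose∘decompose

Path-zero : ∀ {a b} → Path 0 a b ↔ (a ≡ b)
Path-zero = mk↔ₛ′ to from to∘from from∘to
  where
  to : ∀ {a b} → Path 0 a b → a ≡ b
  to [] = refl
  from : ∀ {a b} → a ≡ b → Path 0 a b
  from refl = []
  to∘from : ∀ {a b} (e : a ≡ b) → to (from e) ≡ e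
  to∘from refl = refl
  from∘to : ∀ {a b} (p : Path 0 a b) → from (to p) ≡ p
  from∘to [] = refl

DownFirst : ℕ → ℕ → ℕ → Set
DownFirst n zero          b = ⊥
DownFirst n (suc zero)    b = Path n 0 b
DownFirst n (suc (suc a)) b = Path n (suc a) b ⊎ Path n a b

Path-suc : ∀ {n a b} → Path (suc n) a b ↔ (DownFirst n a b ⊎ (Path n (a + 1) b ⊎ Path n (a + 2) b))
Path-suc = mk↔ₛ′ to (from _) (to∘from _) from∘to
  where
  to : ∀ {n a b} → Path (suc n) a b → DownFirst n a b ⊎ (Path n (a + 1) b ⊎ Path n (a + 2) b)
  to (up1 ∷ p)                       = inj₂ (inj₁ p)
  to (up2 ∷ p)                       = inj₂ (inj₂ p)
  to {a = suc zero}    (down1 ∷ p)   = inj₁ p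
  to {a = suc (suc a)} (down1 ∷ p)   = inj₁ (inj₁ p)
  to (down2 ∷ p)                     = inj₁ (inj₂ p)
  from : ∀ {n b} a → DownFirst n a b ⊎ (Path n (a + 1) b ⊎ Path n (a + 2) b) → Path (suc n) a b
  from a             (inj₂ (inj₁ p)) = up1 ∷ p
  from a             (inj₂ (inj₂ p)) = up2 ∷ p
  from (suc zero)    (inj₁ p)        = down1 ∷ p
  from (suc (suc a)) (inj₁ (inj₁ p)) = down1 ∷ p
  from (suc (suc a)) (inj₁ (inj₂ p)) = down2 ∷ p
  to∘from : ∀ {n b} a (w : DownFirst n a b ⊎ (Path n (a + 1) b ⊎ Path n (a + 2) b)) → to (from a w) ≡ w
  to∘from a             (inj₂ (inj₁ p)) = refl
  to∘from a             (inj₂ (inj₂ p)) = refl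
  to∘from (suc zero)    (inj₁ p)        = refl
  to∘from (suc (suc a)) (inj₁ (inj₁ p)) = refl
  to∘from (suc (suc a)) (inj₁ (inj₂ p)) = refl
  from∘to : ∀ {n a b} (p : Path (suc n) a b) → from a (to p) ≡ p
  from∘to (up1 ∷ p)                     = refl
  from∘to (up2 ∷ p)                     = refl
  from∘to {a = suc zero}    (down1 ∷ p) = refl
  from∘to {a = suc (suc a)} (down1 ∷ p) = refl
  from∘to (down2 ∷ p)                   = refl

Path-finite : ∀ n a b → Finite (Path n a b)
Path-finite zero a b = proj₁ (≡-finite a b) , ↔-trans Path-zero (proj₂ (≡-finite a b))
Path-finite (suc n) a b = _ , ↔-trans Path-suc
  (⊎-↔Fin (proj₂ (DownFirst-finite a)) (⊎-↔Fin (proj₂ (Path-finite n (a + 1) b)) (proj₂ (Path-finite n (a + 2) b))))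
  where
  DownFirst-finite : ∀ a → Finite (DownFirst n a b)
  DownFirst-finite zero          = 0 , ¬⇒↔Fin0 (λ ())
  DownFirst-finite (suc zero)    = Path-finite n 0 b
  DownFirst-finite (suc (suc a)) = _ , ⊎-↔Fin (proj₂ (Path-finite n (suc a) b)) (proj₂ (Path-finite n a b))

paths : ℕ → ℕ → Series
paths a b n = proj₁ (Path-finite n a b)

Path↔paths : ∀ n a b → Path n a b ↔ Fin (paths a b n)
Path↔paths n a b = proj₂ (Path-finite n a b)

raised : ℕ → ℕ → Series
raised a zero    = 𝟘
raised a (suc b) = paths a b

Raised↔raised : ∀ n a b → Raised n a b ↔ Fin (raised a b n)
Raised↔raised n a zero    = ¬⇒↔Fin0 (λ ())
Raised↔raised n a (suc b) = Path↔paths n a b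

Landing↔Fin : ∀ a i → Landing a i ↔ Fin (shift (paths a 0 ⊕ paths a 1) i)
Landing↔Fin a zero    = ¬⇒↔Fin0 (λ ())
Landing↔Fin a (suc i) = ⊎-↔Fin (Path↔paths i a 0) (Path↔paths i a 1)

paths-firstHit : ∀ a b → paths (suc a) b ≗ raised a b ⊕ 𝕏 ⊛ ((paths a 0 ⊕ paths a 1) ⊛ paths 0 b)
paths-firstHit a b n = begin
  paths (suc a) b n
    ≡⟨ ↔Fin-injective (Path↔paths n (suc a) b) (↔-trans Path↔FirstHit
         (⊎-↔Fin (Raised↔raised n a b) (Convolution↔Fin (Landing↔Fin a) (λ j → Path↔paths j 0 b) n))) ⟩
  raised a b n + (shift (paths a 0 ⊕ paths a 1) ⊛ paths 0 b) n
    ≡⟨ cong (raised a b n +_) (trans (shift-⊛ _ _ n) (sym (𝕏⊛≗shift _ n))) ⟩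
  raised a b n + (𝕏 ⊛ ((paths a 0 ⊕ paths a 1) ⊛ paths 0 b)) n ∎
  where open ≡-Reasoning

paths-WalkEquations : WalkEquations (paths 0 0) (paths 0 1) (paths 1 0) (paths 1 1)
paths-WalkEquations = record
  { eq₀₀ = ≗𝟙⊕𝕏⊛ refl (λ n → cong (paths 1 0 n +_) (paths-firstHit 1 0 n))
  ; eq₀₁ = ≗𝕏⊛ refl (λ n → cong (paths 1 1 n +_) (paths-firstHit 1 1 n))
  ; eq₁₀ = paths-firstHit 0 0
  ; eq₁₁ = paths-firstHit 0 1
  }

step : ∀ {a a′} → Move a a′ → Step
step up1   = p1
step up2   = p2
step down1 = m1
step down2 = m2

step-altitude : ∀ {a a′} (m : Move a a′) → ℤ.+ a ℤ.+ stepVal (step m) ≡ ℤ.+ a′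
step-altitude up1   = refl
step-altitude up2   = refl
step-altitude down1 = refl
step-altitude down2 = refl

steps : ∀ {n a b} → Path n a b → List Step
steps []      = []
steps (m ∷ p) = step m ∷ steps p

steps-length : ∀ {n a b} (p : Path n a b) → length' (steps p) ≡ n
steps-length []      = refl
steps-length (m ∷ p) = cong suc (steps-length p)

steps-nonneg : ∀ {n a b} (p : Path n a b) → All (0ℤ ℤ.≤_) (altitudes (ℤ.+ a) (steps p))
steps-nonneg []      = []
steps-nonneg (m ∷ p) rewrite step-altitude m = +≤+ z≤n ∷ steps-nonneg p

steps-final : ∀ {n a b} (p : Path n a b) → finalAltitude (ℤ.+ a) (steps p) ≡ ℤ.+ b
steps-final []      = refl
steps-final (m ∷ p) rewrite step-altitude m = steps-final p

fromSteps : ∀ {n a b} (ss : List Step) → length' ss ≡ n →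
            All (0ℤ ℤ.≤_) (altitudes (ℤ.+ a) ss) → finalAltitude (ℤ.+ a) ss ≡ ℤ.+ b → Path n a b
fromSteps []                                   refl []         refl = []
fromSteps {suc n}                  (p1 ∷ ss) l    (_ ∷ nn)    e    = up1 ∷ fromSteps ss (suc-injective l) nn e
fromSteps {suc n}                  (p2 ∷ ss) l    (_ ∷ nn)    e    = up2 ∷ fromSteps ss (suc-injective l) nn e
fromSteps {suc n} {zero}           (m1 ∷ ss) l    (() ∷ _)    e
fromSteps {suc n} {suc a}          (m1 ∷ ss) l    (_ ∷ nn)    e    = down1 ∷ fromSteps ss (suc-injective l) nn e
fromSteps {suc n} {zero}           (m2 ∷ ss) l    (() ∷ _)    e
fromSteps {suc n} {suc zero}       (m2 ∷ ss) l    (() ∷ _)    e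
fromSteps {suc n} {suc (suc a)}    (m2 ∷ ss) l    (_ ∷ nn)    e    = down2 ∷ fromSteps ss (suc-injective l) nn e

steps-fromSteps : ∀ {n a b} ss l nn (e : finalAltitude (ℤ.+ a) ss ≡ ℤ.+ b) → steps {n} (fromSteps ss l nn e) ≡ ss
steps-fromSteps []                                refl []       refl = refl
steps-fromSteps {suc n}               (p1 ∷ ss) l    (_ ∷ nn)  e    = cong (p1 ∷_) (steps-fromSteps ss _ nn e)
steps-fromSteps {suc n}               (p2 ∷ ss) l    (_ ∷ nn)  e    = cong (p2 ∷_) (steps-fromSteps ss _ nn e)
steps-fromSteps {suc n} {zero}        (m1 ∷ ss) l    (() ∷ _)  e
steps-fromSteps {suc n} {suc a}       (m1 ∷ ss) l    (_ ∷ nn)  e    = cong (m1 ∷_) (steps-fromSteps ss _ nn e)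
steps-fromSteps {suc n} {zero}        (m2 ∷ ss) l    (() ∷ _)  e
steps-fromSteps {suc n} {suc zero}    (m2 ∷ ss) l    (() ∷ _)  e
steps-fromSteps {suc n} {suc (suc a)} (m2 ∷ ss) l    (_ ∷ nn)  e    = cong (m2 ∷_) (steps-fromSteps ss _ nn e)

fromSteps-steps : ∀ {n a b} (p : Path n a b) l nn e → fromSteps (steps p) l nn e ≡ p
fromSteps-steps []          refl []       refl = refl
fromSteps-steps (up1 ∷ p)   l    (_ ∷ nn) e    = cong (up1 ∷_) (fromSteps-steps p _ nn e)
fromSteps-steps (up2 ∷ p)   l    (_ ∷ nn) e    = cong (up2 ∷_) (fromSteps-steps p _ nn e)
fromSteps-steps (down1 ∷ p) l    (_ ∷ nn) e    = cong (down1 ∷_) (fromSteps-steps p _ nn e)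
fromSteps-steps (down2 ∷ p) l    (_ ∷ nn) e    = cong (down2 ∷_) (fromSteps-steps p _ nn e)

Walk-≡ : ∀ {n} {w w′ : Walk n} → Walk.steps w ≡ Walk.steps w′ → w ≡ w′
Walk-≡ {w = walk ss l nn e} {walk .ss l′ nn′ e′} refl
  rewrite uip l l′ | uip e e′ | All.irrelevant ≤-irrelevant nn nn′ = refl

Walk↔Path : ∀ {n} → Walk n ↔ Path n 0 1
Walk↔Path = mk↔ₛ′ to from (λ p → fromSteps-steps p _ _ _) from∘to
  where
  to : ∀ {n} → Walk n → Path n 0 1
  to (walk ss l nn e) = fromSteps ss l nn e
  from : ∀ {n} → Path n 0 1 → Walk n
  from p = walk (steps p) (steps-length p) (steps-nonneg p) (steps-final p)
  from∘to : ∀ {n} (w : Walk n) → from (to w) ≡ w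
  from∘to (walk ss l nn e) = Walk-≡ (steps-fromSteps ss l nn e)

-- Bracketings by value

ValuedBracketing : Bool → ℕ → Set
ValuedBracketing v N = Σ (Bracketing N) (λ t → eval t ≡ v)

Bracketing-nonempty : ∀ {N} → Bracketing N → 1 ≤ N
Bracketing-nonempty leaf                 = s≤s z≤n
Bracketing-nonempty (node {m} {k} l r) = ≤-trans (Bracketing-nonempty l) (m≤m+n m k)

¬ValuedBracketing-zero : ∀ {v} → ¬ ValuedBracketing v 0
¬ValuedBracketing-zero (t , _) with Bracketing-nonempty t
... | ()

ValuedBracketing-root : ∀ {v N} → ValuedBracketing v N ↔
  ((false ≡ v) × (N ≡ 1) ⊎ Σ Bool λ x → Σ Bool λ y → pow x y ≡ v × Convolution (ValuedBracketing x) (ValuedBracketing y) N)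
ValuedBracketing-root = mk↔ₛ′ to from to∘from from∘to
  where
  Root : Bool → ℕ → Set
  Root v N = (false ≡ v) × (N ≡ 1) ⊎ Σ Bool λ x → Σ Bool λ y → pow x y ≡ v × Convolution (ValuedBracketing x) (ValuedBracketing y) N
  to : ∀ {v N} → ValuedBracketing v N → Root v N
  to (leaf , e)                   = inj₁ (e , refl)
  to (node {m} {k} l r , e) = inj₂ (eval l , eval r , e , m , k , refl , (l , refl) , (r , refl))
  from : ∀ {v N} → Root v N → ValuedBracketing v N
  from (inj₁ (e , refl))                                               = leaf , e
  from (inj₂ (x , y , e , m , k , refl , (l , refl) , (r , refl))) = node l r , e
  to∘from : ∀ {v N} (w : Root v N) → to (from w) ≡ w
  to∘from (inj₁ (e , refl))                                               = refl
  to∘from (inj₂ (x , y , e , m , k , refl , (l , refl) , (r , refl))) = refl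
  from∘to : ∀ {v N} (w : ValuedBracketing v N) → from (to w) ≡ w
  from∘to (leaf , e)     = refl
  from∘to (node l r , e) = refl

ValuedBracketing-false-one : ValuedBracketing false 1 ↔ Fin 1
ValuedBracketing-false-one = ↔-trans ValuedBracketing-root
  (⊎-↔Fin (↔-trans (mk↔ₛ′ (λ _ → tt) (λ _ → refl , refl) (λ _ → refl) λ { (refl , refl) → refl }) (↔-sym 1↔⊤))
          (¬⇒↔Fin0 λ { (_ , _ , _ , c) → Convolution-one ¬ValuedBracketing-zero ¬ValuedBracketing-zero c }))

¬ValuedBracketing-true-one : ¬ ValuedBracketing true 1
¬ValuedBracketing-true-one w with Inverse.to ValuedBracketing-root w
... | inj₁ (() , _)
... | inj₂ (_ , _ , _ , c) = Convolution-one ¬ValuedBracketing-zero ¬ValuedBracketing-zero c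

module _ {D : Bool → Bool → Set} where

  pow-false : (Σ Bool λ x → Σ Bool λ y → pow x y ≡ false × D x y) ↔ D false true
  pow-false = mk↔ₛ′ to (λ d → false , true , refl , d) (λ _ → refl) from∘to
    where
    to : (Σ Bool λ x → Σ Bool λ y → pow x y ≡ false × D x y) → D false true
    to (false , true , refl , d) = d
    from∘to : ∀ w → (false , true , refl , to w) ≡ w
    from∘to (false , true , refl , d) = refl

  pow-true : (Σ Bool λ x → Σ Bool λ y → pow x y ≡ true × D x y) ↔ ((D true true ⊎ D true false) ⊎ D false false)
  pow-true = mk↔ₛ′ to from to∘from from∘to
    where
    to : (Σ Bool λ x → Σ Bool λ y → pow x y ≡ true × D x y) → (D true true ⊎ D true false) ⊎ D false false
    to (true  , true  , refl , d) = inj₁ (inj₁ d)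
    to (true  , false , refl , d) = inj₁ (inj₂ d)
    to (false , false , refl , d) = inj₂ d
    from : (D true true ⊎ D true false) ⊎ D false false → Σ Bool λ x → Σ Bool λ y → pow x y ≡ true × D x y
    from (inj₁ (inj₁ d)) = true  , true  , refl , d
    from (inj₁ (inj₂ d)) = true  , false , refl , d
    from (inj₂ d)        = false , false , refl , d
    to∘from : ∀ w → to (from w) ≡ w
    to∘from (inj₁ (inj₁ d)) = refl
    to∘from (inj₁ (inj₂ d)) = refl
    to∘from (inj₂ d)        = refl
    from∘to : ∀ w → from (to w) ≡ w
    from∘to (true  , true  , refl , d) = refl
    from∘to (true  , false , refl , d) = refl
    from∘to (false , false , refl , d) = refl

Branches : Bool → Bool → ℕ → Set
Branches x y = Convolution (λ i → ValuedBracketing x (suc i)) (λ j → ValuedBracketing y (suc j))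

ValuedBracketing-false-suc : ∀ {n} → ValuedBracketing false (2 + n) ↔ Branches false true n
ValuedBracketing-false-suc = ↔-trans ValuedBracketing-root
  (↔-trans (¬⇒⊎-identityˡ (λ { (_ , ()) })) (↔-trans pow-false
  (Convolution-shift ¬ValuedBracketing-zero ¬ValuedBracketing-zero)))

ValuedBracketing-true-suc : ∀ {n} →
  ValuedBracketing true (2 + n) ↔ ((Branches true true n ⊎ Branches true false n) ⊎ Branches false false n)
ValuedBracketing-true-suc = ↔-trans ValuedBracketing-root
  (↔-trans (¬⇒⊎-identityˡ (λ { (() , _) })) (↔-trans pow-true
  ((shift-branches ⊎-cong shift-branches) ⊎-cong shift-branches)))
  where
  shift-branches : ∀ {x y n} → Convolution (ValuedBracketing x) (ValuedBracketing y) (2 + n) ↔ Branches x y n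
  shift-branches = Convolution-shift ¬ValuedBracketing-zero ¬ValuedBracketing-zero

ValuedBracketing-finite : ∀ N v → Finite (ValuedBracketing v N)
ValuedBracketing-finite = <-rec _ finite
  where
  finite : ∀ N → (∀ {M} → M < N → ∀ v → Finite (ValuedBracketing v M)) → ∀ v → Finite (ValuedBracketing v N)
  finite zero          _   v     = 0 , ¬⇒↔Fin0 ¬ValuedBracketing-zero
  finite (suc zero)    _   false = 1 , ValuedBracketing-false-one
  finite (suc zero)    _   true  = 0 , ¬⇒↔Fin0 ¬ValuedBracketing-true-one
  finite (suc (suc n)) rec = finite-suc-suc
    where
    Branches-finite : ∀ x y → Finite (Branches x y n)
    Branches-finite x y = Convolution-finite n (λ i≤n → rec (s≤s (s≤s i≤n)) x) (λ j≤n → rec (s≤s (s≤s j≤n)) y)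

    finite-suc-suc : ∀ v → Finite (ValuedBracketing v (2 + n))
    finite-suc-suc false = _ , ↔-trans ValuedBracketing-false-suc (proj₂ (Branches-finite false true))
    finite-suc-suc true  = _ , ↔-trans ValuedBracketing-true-suc
      (⊎-↔Fin (⊎-↔Fin (proj₂ (Branches-finite true true)) (proj₂ (Branches-finite true false)))
              (proj₂ (Branches-finite false false)))

zeros ones : Series
zeros i = proj₁ (ValuedBracketing-finite (suc i) false)
ones  i = proj₁ (ValuedBracketing-finite (suc i) true)

zeros↔ : ∀ i → ValuedBracketing false (suc i) ↔ Fin (zeros i)
zeros↔ i = proj₂ (ValuedBracketing-finite (suc i) false)

ones↔ : ∀ i → ValuedBracketing true (suc i) ↔ Fin (ones i)
ones↔ i = proj₂ (ValuedBracketing-finite (suc i) true)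

ValuedBracketing-false-suc↔zeros⊛ones : ∀ n → ValuedBracketing false (2 + n) ↔ Fin ((zeros ⊛ ones) n)
ValuedBracketing-false-suc↔zeros⊛ones n = ↔-trans ValuedBracketing-false-suc (Convolution↔Fin zeros↔ ones↔ n)

zeros-eq : zeros ≗ 𝟙 ⊕ 𝕏 ⊛ (zeros ⊛ ones)
zeros-eq = ≗𝟙⊕𝕏⊛ (↔Fin-injective (zeros↔ 0) ValuedBracketing-false-one)
  (λ n → ↔Fin-injective (zeros↔ (suc n)) (ValuedBracketing-false-suc↔zeros⊛ones n))

ones-eq : ones ≗ 𝕏 ⊛ (ones ⊛ ones ⊕ ones ⊛ zeros ⊕ zeros ⊛ zeros)
ones-eq = ≗𝕏⊛ (↔Fin-injective (ones↔ 0) (¬⇒↔Fin0 ¬ValuedBracketing-true-one))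
  (λ n → ↔Fin-injective (ones↔ (suc n)) (↔-trans ValuedBracketing-true-suc
    (⊎-↔Fin (⊎-↔Fin (Convolution↔Fin ones↔ ones↔ n) (Convolution↔Fin ones↔ zeros↔ n))
            (Convolution↔Fin zeros↔ zeros↔ n))))

mainTheorem20 : (n : ℕ) →
    Σ ℕ (λ k → (Walk n ↔ Fin k) × (ZeroBracketing (n + 2) ↔ Fin k))
mainTheorem20 n = paths 0 1 n , ↔-trans Walk↔Path (Path↔paths n 0 1) , zeroBracketings
  where
  paths₀₁≗zeros⊛ones : paths 0 1 ≗ zeros ⊛ ones
  paths₀₁≗zeros⊛ones =
    proj₁ (proj₂ (WalkEquations-unique paths-WalkEquations (tree-WalkEquations zeros-eq ones-eq)))

  zeroBracketings : ZeroBracketing (n + 2) ↔ Fin (paths 0 1 n)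
  zeroBracketings = subst₂ (λ N k → ZeroBracketing N ↔ Fin k)
    (+-comm 2 n) (sym (paths₀₁≗zeros⊛ones n)) (ValuedBracketing-false-suc↔zeros⊛ones n)
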